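{- Let $p \geq 5$ be prime and $A \subseteq \mathbb{Z}_p^2$ with $|A| = 2p+1$. Let $H$ be a subgroup of $\mathbb{Z}_p^2$ of order $p$, with cosets indexed $H_0 = H, H_1, \dots, H_{p-1}$ so that $H_i + H_j = H_{i+j}$ (indices mod $p$), and put $A_i = A \cap H_i$. Assume $|A_0| \geq |A_i|$ for all $i$. Let $m$ be the number of $i \in \{1,\dots,p-1\}$ with $A_i \neq \emptyset$. Suppose $|A_0| \leq \frac{p+1}{2}$ and $m \leq \frac{p-1}{2}$. Then $|\hat{2}A| \geq 4p$, where $\hat{2}A = \{a_1+a_2 \mid a_1,a_2 \in A, a_1 \neq a_2\}$. -}

module Defs where

open import Data.Nat using (ℕ; suc; NonZero; _+_; _*_; _≤?_)
open import Data.Nat.DivMod using (_mod_)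
open import Data.Fin using (Fin; toℕ) renaming (zero to fzero)
open import Data.Fin.Properties using (_≟_) renaming (any? to anyFin?)
import Relation.Nullary.Decidable as Dec
open import Data.Product using (_×_; _,_; ∃; ∃-syntax; proj₁; proj₂)
open import Data.Product.Properties using (≡-dec)
open import Data.List using (List; length; filter; allFin; cartesianProduct)
open import Data.List.Membership.Propositional using (_∈_)
open import Relation.Binary.PropositionalEquality using (_≡_)
open import Relation.Nullary using (¬_; Dec)
open import Relation.Nullary.Decidable using (_×-dec_; ¬?)
open import Relation.Unary using (Pred; Decidable)
open import Level using (0ℓ)

ℤ_ : (p : ℕ) → Set
ℤ p = Fin p

addℤ : (p : ℕ) .{{_ : NonZero p}} → ℤ p → ℤ p → ℤ p
addℤ p x y = (toℕ x + toℕ y) mod p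

negℤ : (p : ℕ) .{{_ : NonZero p}} → ℤ p → ℤ p
negℤ (suc k) x = ((suc k) Data.Nat.∸ toℕ x) mod (suc k)
  where import Data.Nat

zeroℤ : (p : ℕ) .{{_ : NonZero p}} → ℤ p
zeroℤ (suc k) = fzero

ℤ² : ℕ → Set
ℤ² p = ℤ p × ℤ p

add² : (p : ℕ) .{{_ : NonZero p}} → ℤ² p → ℤ² p → ℤ² p
add² p (a , b) (c , d) = addℤ p a c , addℤ p b d

zero² : (p : ℕ) .{{_ : NonZero p}} → ℤ² p
zero² (suc k) = fzero , fzero

neg² : (p : ℕ) .{{_ : NonZero p}} → ℤ² p → ℤ² p
neg² p (a , b) = negℤ p a , negℤ p b

_≟²_ : {p : ℕ} → (x y : ℤ² p) → Dec (x ≡ y)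
_≟²_ = ≡-dec _≟_ _≟_

allℤ² : (p : ℕ) → List (ℤ² p)
allℤ² p = cartesianProduct (allFin p) (allFin p)

card² : (p : ℕ) {P : Pred (ℤ² p) 0ℓ} → Decidable P → ℕ
card² p P? = length (filter P? (allℤ² p))

record IsSubgroup (p : ℕ) .{{_ : NonZero p}} (H : Pred (ℤ² p) 0ℓ) : Set where
  field
    has-zero : H (zero² p)
    add-closed : ∀ {x y} → H x → H y → H (add² p x y)
    neg-closed : ∀ {x} → H x → H (neg² p x)

-- An indexing of the cosets of H by ℤ_p: ι x = i means x ∈ H_i.
record IsCosetIndexing (p : ℕ) .{{_ : NonZero p}} (H : Pred (ℤ² p) 0ℓ)
                       (ι : ℤ² p → ℤ p) : Set where
  field
    same-coset : ∀ x y → (ι x ≡ ι y → H (add² p x (neg² p y)))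
                         × (H (add² p x (neg² p y)) → ι x ≡ ι y)
    surjective : ∀ i → ∃[ x ] ι x ≡ i
    zero-coset : ∀ x → (ι x ≡ zeroℤ p → H x) × (H x → ι x ≡ zeroℤ p)
    additive   : ∀ x y → ι (add² p x y) ≡ addℤ p (ι x) (ι y)

Aᵢ? : (p : ℕ) {A : Pred (ℤ² p) 0ℓ} → Decidable A → (ι : ℤ² p → ℤ p) → (i : ℤ p)
     → Decidable (λ x → A x × ι x ≡ i)
Aᵢ? p A? ι i x = A? x ×-dec (ι x ≟ i)

cardAᵢ : (p : ℕ) {A : Pred (ℤ² p) 0ℓ} → Decidable A → (ι : ℤ² p → ℤ p) → ℤ p → ℕ
cardAᵢ p A? ι i = card² p (Aᵢ? p A? ι i)

InRestrictedSumset : (p : ℕ) .{{_ : NonZero p}} → Pred (ℤ² p) 0ℓ → Pred (ℤ² p) 0ℓ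
InRestrictedSumset p A g = ∃[ a₁ ] ∃[ a₂ ] (A a₁ × A a₂ × ¬ (a₁ ≡ a₂) × add² p a₁ a₂ ≡ g)

any²? : {p : ℕ} {P : Pred (ℤ² p) 0ℓ} → Decidable P → Dec (∃ P)
any²? {p} {P} P? =
  Dec.map′ (λ { (a , b , h) → (a , b) , h }) (λ { ((a , b) , h) → a , b , h })
           (anyFin? (λ a → anyFin? (λ b → P? (a , b))))

InRestrictedSumset? : (p : ℕ) .{{_ : NonZero p}} {A : Pred (ℤ² p) 0ℓ} → Decidable A
                      → Decidable (InRestrictedSumset p A)
InRestrictedSumset? p {A} A? g =
  Dec.map′ (λ { (a₁ , a₂ , h) → a₁ , a₂ , h }) (λ { (a₁ , a₂ , h) → a₁ , a₂ , h })
    (any²? (λ a₁ → any²? (λ a₂ →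
      A? a₁ ×-dec (A? a₂ ×-dec (¬? (a₁ ≟² a₂) ×-dec (add² p a₁ a₂ ≟² g))))))

cardRestrictedSumset : (p : ℕ) .{{_ : NonZero p}} {A : Pred (ℤ² p) 0ℓ} → Decidable A → ℕ
cardRestrictedSumset p A? = card² p (InRestrictedSumset? p A?)

nonEmptyCosetCount : (p : ℕ) .{{_ : NonZero p}} {A : Pred (ℤ² p) 0ℓ} → Decidable A
                     → (ι : ℤ² p → ℤ p) → ℕ
nonEmptyCosetCount p A? ι =
  length (filter (λ i → ¬? (i ≟ zeroℤ p) ×-dec (1 ≤? cardAᵢ p A? ι i)) (allFin p))

module Submission where

-- Write aᵢ = |A ∩ Hᵢ| and rᵢ = |2^A ∩ Hᵢ|, so that |2^A| = Σᵢ rᵢ, and bound every rᵢ.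
-- Translating A₀ ∖ {y} by y ∈ A₀ gives r₀ ≥ a₀ − 1.  For i ≠ 0 with Aᵢ ≠ ∅ every sum in
-- A₀ + Aᵢ is restricted, so Cauchy–Davenport in ℤₚ² gives rᵢ ≥ a₀ + aᵢ − 1.  An empty
-- coset H_{j+l} with j ≠ 0 and y ∈ Aₗ contains (Aⱼ ∖ {y}) + y, so r_{j+l} ≥ aⱼ − 1.  Layer
-- this last bound by Lₜ = {j ≠ 0 : aⱼ ≥ t + 2} and S = {i : Aᵢ ≠ ∅}: an empty coset lying
-- in Lₜ + S for s values of t receives at least s restricted sums, and by Cauchy–Davenport
-- in ℤₚ at least |Lₜ| − 1 empty cosets lie in Lₜ + S.  Summing everything, with m the
-- number of occupied cosets other than H₀, gives |2^A| ≥ m (a₀ − 2) + 2 (|A| − a₀); the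
-- size hypotheses force a₀ ≥ 4 and m ≥ 3, and then |2^A| ≥ 4p + a₀ − 4 ≥ 4p.

open import Defs
open import Algebra.Bundles using (AbelianGroup)
open import Algebra.Consequences.Propositional using (comm∧idʳ⇒id; comm∧invʳ⇒inv)
open import Algebra.Core using (Op₁; Op₂)
open import Algebra.Structures using (IsAbelianGroup)
open import Data.Bool using (true; false)
open import Data.Empty using (⊥-elim)
open import Data.Fin using (Fin; toℕ) renaming (zero to fzero)
open import Data.Fin.Properties using (toℕ-injective; toℕ<n; toℕ-fromℕ<; _≟_)
open import Data.List using (List; []; _∷_; length; filter; map; allFin; downFrom; applyUpTo)
open import Data.List.Membership.Propositional using (_∈_; _─_; lose)
open import Data.List.Membership.Propositional.Properties
  using (∈-filter⁺; ∈-filter⁻; ∈-map⁻; ∈-applyUpTo⁻; ∈-allFin; ∈-cartesianProduct⁺)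
open import Data.List.Properties using (length-removeAt′; length-map; length-applyUpTo; length-downFrom)
import Data.List.Relation.Unary.All as All
open import Data.List.Relation.Unary.AllPairs using ([]; _∷_)
open import Data.List.Relation.Unary.Any using (here; there; index; satisfied; any?)
open import Data.List.Relation.Unary.Unique.Propositional using (Unique)
import Data.List.Relation.Unary.Unique.Propositional.Properties as Unique
open import Data.Nat using (ℕ; zero; suc; _+_; _*_; _∸_; _≤_; _<_; _⊓_; z≤n; s≤s; _≤?_; NonZero; >-nonZero)
open import Data.Nat.Properties hiding (_≟_)
open import Algebra.Properties.CommutativeSemigroup +-commutativeSemigroup
  using () renaming (interchange to +-interchange)
open import Data.Nat.Tactic.RingSolver using (solve; solve-∀)
open import Data.Nat.DivMod using (_%_; _/_; _mod_; m≡m%n+[m/n]*n; %-distribˡ-+; m%n%n≡m%n; m<n⇒m%n≡m; n%n≡0)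
open import Data.Nat.Divisibility using (_∣_; divides; >⇒∤)
open import Data.Nat.Primality using (Prime; euclidsLemma)
open import Data.Product using (_×_; _,_; proj₁; proj₂; swap; ∃; ∃-syntax)
open import Data.Sum using (_⊎_; inj₁; inj₂)
open import Function using (_∘_)
open import Level using (0ℓ)
open import Relation.Binary.Definitions using (DecidableEquality; tri<; tri≈; tri>)
open import Relation.Binary.PropositionalEquality
open import Relation.Nullary using (¬_; Dec; _because_; yes; no; contradiction)
open import Relation.Nullary.Decidable using (_×-dec_; _⊎-dec_; ¬?; decidable-stable)
open import Relation.Unary using (Pred; Decidable; _⊆_)

∑ : {A : Set} → List A → (A → ℕ) → ℕ
∑ []       f = 0
∑ (x ∷ xs) f = f x + ∑ xs f

syntax ∑ xs (λ x → e) = ∑[ x ∈ xs ] e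

module _ {A : Set} where

  ∑-cong : (xs : List A) {f g : A → ℕ} → (∀ x → f x ≡ g x) → ∑ xs f ≡ ∑ xs g
  ∑-cong []       f≗g = refl
  ∑-cong (x ∷ xs) f≗g = cong₂ _+_ (f≗g x) (∑-cong xs f≗g)

  ∑-mono-≤ : (xs : List A) {f g : A → ℕ} → (∀ x → f x ≤ g x) → ∑ xs f ≤ ∑ xs g
  ∑-mono-≤ []       f≤g = z≤n
  ∑-mono-≤ (x ∷ xs) f≤g = +-mono-≤ (f≤g x) (∑-mono-≤ xs f≤g)

  ∑-distrib-+ : (xs : List A) (f g : A → ℕ) → ∑[ x ∈ xs ] (f x + g x) ≡ ∑ xs f + ∑ xs g
  ∑-distrib-+ []       f g = refl
  ∑-distrib-+ (x ∷ xs) f g =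
    trans (cong (f x + g x +_) (∑-distrib-+ xs f g)) (+-interchange (f x) (g x) (∑ xs f) (∑ xs g))

  ∑-*ˡ : (xs : List A) (c : ℕ) (f : A → ℕ) → ∑[ x ∈ xs ] (c * f x) ≡ c * ∑ xs f
  ∑-*ˡ []       c f = sym (*-zeroʳ c)
  ∑-*ˡ (x ∷ xs) c f = trans (cong (c * f x +_) (∑-*ˡ xs c f)) (sym (*-distribˡ-+ c (f x) (∑ xs f)))

  ∑1≡length : (xs : List A) → ∑[ _ ∈ xs ] 1 ≡ length xs
  ∑1≡length []       = refl
  ∑1≡length (x ∷ xs) = cong suc (∑1≡length xs)

  ∑-zero : (xs : List A) → ∑[ x ∈ xs ] 0 ≡ 0
  ∑-zero []       = refl
  ∑-zero (x ∷ xs) = ∑-zero xs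

∑-comm : {A B : Set} (xs : List A) (ys : List B) (f : A → B → ℕ) →
         ∑[ x ∈ xs ] ∑[ y ∈ ys ] f x y ≡ ∑[ y ∈ ys ] ∑[ x ∈ xs ] f x y
∑-comm []       ys f = sym (∑-zero ys)
∑-comm (x ∷ xs) ys f = trans (cong (∑ ys (f x) +_) (∑-comm xs ys f))
                             (sym (∑-distrib-+ ys (f x) (λ y → ∑[ x ∈ xs ] f x y)))

-- Matching on `does` alone lets 𝟙 (¬? (yes p) ×-dec d) reduce for an unknown decision d.
𝟙 : {P : Set} → Dec P → ℕ
𝟙 (true  because _) = 1
𝟙 (false because _) = 0

𝟙-yes : {P : Set} (P? : Dec P) → P → 𝟙 P? ≡ 1
𝟙-yes (yes _) _  = refl
𝟙-yes (no ¬p) p = ⊥-elim (¬p p)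

𝟙-no : {P : Set} (P? : Dec P) → ¬ P → 𝟙 P? ≡ 0
𝟙-no (yes p) ¬p = ⊥-elim (¬p p)
𝟙-no (no _)  _  = refl

𝟙≤1 : {P : Set} (P? : Dec P) → 𝟙 P? ≤ 1
𝟙≤1 (yes _) = ≤-refl
𝟙≤1 (no _)  = z≤n

module _ {P Q : Set} where

  𝟙-mono : (P? : Dec P) (Q? : Dec Q) → (P → Q) → 𝟙 P? ≤ 𝟙 Q?
  𝟙-mono (yes p) Q? P⇒Q = ≤-reflexive (sym (𝟙-yes Q? (P⇒Q p)))
  𝟙-mono (no _)  Q? P⇒Q = z≤n

  𝟙-× : (P? : Dec P) (Q? : Dec Q) → 𝟙 (P? ×-dec Q?) ≡ 𝟙 P? * 𝟙 Q?
  𝟙-× (yes _) (yes _) = refl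
  𝟙-× (yes _) (no _)  = refl
  𝟙-× (no _)  _       = refl

  𝟙-split : (P? : Dec P) (Q? : Dec Q) → 𝟙 P? ≡ 𝟙 (P? ×-dec Q?) + 𝟙 (P? ×-dec ¬? Q?)
  𝟙-split (yes _) (yes _) = refl
  𝟙-split (yes _) (no _)  = refl
  𝟙-split (no _)  _       = refl

∑𝟙≤length : {A : Set} {P : Pred A 0ℓ} (P? : Decidable P) (xs : List A) → ∑[ x ∈ xs ] 𝟙 (P? x) ≤ length xs
∑𝟙≤length P? []       = z≤n
∑𝟙≤length P? (x ∷ xs) = +-mono-≤ (𝟙≤1 (P? x)) (∑𝟙≤length P? xs)

length-filter≡∑𝟙 : {A : Set} {P : Pred A 0ℓ} (P? : Decidable P) (xs : List A) →
                   length (filter P? xs) ≡ ∑[ x ∈ xs ] 𝟙 (P? x)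
length-filter≡∑𝟙 P? []       = refl
length-filter≡∑𝟙 P? (x ∷ xs) with P? x
... | yes _ = cong suc (length-filter≡∑𝟙 P? xs)
... | no _  = length-filter≡∑𝟙 P? xs

∑𝟙-downFrom≤ : ∀ K {u : ℕ → Set} (u? : ∀ t → Dec (u t)) {F : ℕ} → (∀ t → u t → suc t ≤ F) →
               ∑[ t ∈ downFrom K ] 𝟙 (u? t) ≤ F
∑𝟙-downFrom≤ zero    u? u⇒t<F = z≤n
∑𝟙-downFrom≤ (suc K) u? u⇒t<F with u? K
... | yes uK = ≤-trans (s≤s (≤-trans (∑𝟙≤length u? (downFrom K)) (≤-reflexive (length-downFrom K))))
                       (u⇒t<F K uK)
... | no _   = ∑𝟙-downFrom≤ K u? u⇒t<F

∑𝟙-downFrom-< : ∀ K b → ∑[ t ∈ downFrom K ] 𝟙 (suc t ≤? b) ≡ K ⊓ b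
∑𝟙-downFrom-< zero    b = refl
∑𝟙-downFrom-< (suc K) b with suc K ≤? b
... | yes K<b = trans (cong suc (trans (∑𝟙-downFrom-< K b) (m≤n⇒m⊓n≡m (<⇒≤ K<b)))) (sym (m≤n⇒m⊓n≡m K<b))
... | no  K≮b = trans (∑𝟙-downFrom-< K b) (trans (m≥n⇒m⊓n≡n b≤K) (sym (m≥n⇒m⊓n≡n (m≤n⇒m≤1+n b≤K))))
  where b≤K = ≤-pred (≰⇒> K≮b)

module _ {A : Set} where

  ∈-─ : ∀ {x y} {ys : List A} (x∈ys : x ∈ ys) → y ∈ ys → y ≢ x → y ∈ ys ─ x∈ys
  ∈-─ (here refl) (here refl) y≢x = ⊥-elim (y≢x refl)
  ∈-─ (here refl) (there y∈)  _   = y∈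
  ∈-─ (there x∈)  (here refl) _   = here refl
  ∈-─ (there x∈)  (there y∈)  y≢x = there (∈-─ x∈ y∈ y≢x)

  unique⇒length≤ : ∀ {xs ys : List A} → Unique xs → (∀ {x} → x ∈ xs → x ∈ ys) → length xs ≤ length ys
  unique⇒length≤ {[]}     _            _   = z≤n
  unique⇒length≤ {x ∷ xs} {ys} (x∉xs ∷ xs!) xs⊆ys = begin
    suc (length xs)          ≤⟨ s≤s (unique⇒length≤ xs! xs⊆ys─x) ⟩
    suc (length (ys ─ x∈ys)) ≡⟨ length-removeAt′ ys (index x∈ys) ⟨
    length ys                ∎
    where
    open ≤-Reasoning
    x∈ys = xs⊆ys (here refl)
    xs⊆ys─x : ∀ {y} → y ∈ xs → y ∈ ys ─ x∈ys
    xs⊆ys─x y∈xs = ∈-─ x∈ys (xs⊆ys (there y∈xs)) (All.lookup x∉xs y∈xs ∘ sym)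

module Counting {G : Set} (_≟_ : DecidableEquality G) (elems : List G)
                (∈-elems : ∀ x → x ∈ elems) (elems! : Unique elems) where

  ∣_∣ : {P : Pred G 0ℓ} → Decidable P → ℕ
  ∣ P? ∣ = length (filter P? elems)

  _∖[_] : {P : Pred G 0ℓ} → Decidable P → (y : G) → Decidable (λ x → P x × x ≢ y)
  (P? ∖[ y ]) x = P? x ×-dec ¬? (x ≟ y)

  module _ {P : Pred G 0ℓ} (P? : Decidable P) where

    ∣∣≡∑𝟙 : ∣ P? ∣ ≡ ∑[ x ∈ elems ] 𝟙 (P? x)
    ∣∣≡∑𝟙 = length-filter≡∑𝟙 P? elems

    length≤∣∣ : {xs : List G} → Unique xs → (∀ {x} → x ∈ xs → P x) → length xs ≤ ∣ P? ∣
    length≤∣∣ xs! xs⊆P = unique⇒length≤ xs! (λ {x} x∈xs → ∈-filter⁺ P? (∈-elems x) (xs⊆P x∈xs))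

    ∣∣>0 : ∀ {x} → P x → 1 ≤ ∣ P? ∣
    ∣∣>0 px = length≤∣∣ (All.[] ∷ []) (λ { (here refl) → px })

    ∃? : Dec (∃ P)
    ∃? with any? P? elems
    ... | yes p∈ = yes (satisfied p∈)
    ... | no ¬p∈ = no (λ (x , px) → ¬p∈ (lose (∈-elems x) px))

    ∣∣>0⇒∃ : 1 ≤ ∣ P? ∣ → ∃ P
    ∣∣>0⇒∃ ∣P∣>0 with filter P? elems in eq
    ∣∣>0⇒∃ () | []
    ... | x ∷ _ = x , proj₂ (∈-filter⁻ P? {xs = elems} (subst (x ∈_) (sym eq) (here refl)))


  ∣∣-mono : {P Q : Pred G 0ℓ} (P? : Decidable P) (Q? : Decidable Q) → P ⊆ Q → ∣ P? ∣ ≤ ∣ Q? ∣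
  ∣∣-mono P? Q? P⊆Q = begin
    ∣ P? ∣                  ≡⟨ ∣∣≡∑𝟙 P? ⟩
    ∑[ x ∈ elems ] 𝟙 (P? x) ≤⟨ ∑-mono-≤ elems (λ x → 𝟙-mono (P? x) (Q? x) P⊆Q) ⟩
    ∑[ x ∈ elems ] 𝟙 (Q? x) ≡⟨ ∣∣≡∑𝟙 Q? ⟨
    ∣ Q? ∣                  ∎
    where open ≤-Reasoning

  ∣∣-cong : {P Q : Pred G 0ℓ} (P? : Decidable P) (Q? : Decidable Q) → P ⊆ Q → Q ⊆ P → ∣ P? ∣ ≡ ∣ Q? ∣
  ∣∣-cong P? Q? P⊆Q Q⊆P = ≤-antisym (∣∣-mono P? Q? P⊆Q) (∣∣-mono Q? P? Q⊆P)

  ∣∣-split : {P Q : Pred G 0ℓ} (P? : Decidable P) (Q? : Decidable Q) →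
             ∣ P? ∣ ≡ ∣ (λ x → P? x ×-dec Q? x) ∣ + ∣ (λ x → P? x ×-dec ¬? (Q? x)) ∣
  ∣∣-split P? Q? = begin
    ∣ P? ∣                                       ≡⟨ ∣∣≡∑𝟙 P? ⟩
    ∑[ x ∈ elems ] 𝟙 (P? x)                      ≡⟨ ∑-cong elems (λ x → 𝟙-split (P? x) (Q? x)) ⟩
    ∑[ x ∈ elems ] (𝟙 (P? x ×-dec Q? x) + 𝟙 (P? x ×-dec ¬? (Q? x)))
      ≡⟨ ∑-distrib-+ elems _ _ ⟩
    ∑[ x ∈ elems ] 𝟙 (P? x ×-dec Q? x) + ∑[ x ∈ elems ] 𝟙 (P? x ×-dec ¬? (Q? x))
      ≡⟨ cong₂ _+_ (∣∣≡∑𝟙 (λ x → P? x ×-dec Q? x)) (∣∣≡∑𝟙 (λ x → P? x ×-dec ¬? (Q? x))) ⟨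
    ∣ (λ x → P? x ×-dec Q? x) ∣ + ∣ (λ x → P? x ×-dec ¬? (Q? x)) ∣ ∎
    where open ≡-Reasoning

  ∣∣-injection : {P Q : Pred G 0ℓ} (P? : Decidable P) (Q? : Decidable Q) (f : G → G) →
                 (∀ {x y} → f x ≡ f y → x ≡ y) → (∀ {x} → P x → Q (f x)) → ∣ P? ∣ ≤ ∣ Q? ∣
  ∣∣-injection {Q = Q} P? Q? f f-inj f[P]⊆Q = begin
    ∣ P? ∣                           ≡⟨ length-map f (filter P? elems) ⟨
    length (map f (filter P? elems)) ≤⟨ length≤∣∣ Q? (Unique.map⁺ f-inj (Unique.filter⁺ P? elems!)) f[P]∈Q ⟩
    ∣ Q? ∣                           ∎
    where
    open ≤-Reasoning
    f[P]∈Q : ∀ {y} → y ∈ map f (filter P? elems) → Q y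
    f[P]∈Q y∈ with ∈-map⁻ f y∈
    ... | x , x∈ , refl = f[P]⊆Q (proj₂ (∈-filter⁻ P? {xs = elems} x∈))


  ∣≡∣≤1 : ∀ y → ∣ (_≟ y) ∣ ≤ 1
  ∣≡∣≤1 y = unique⇒length≤ {ys = y ∷ []} (Unique.filter⁺ (_≟ y) elems!)
              (λ x∈ → here (proj₂ (∈-filter⁻ (_≟ y) {xs = elems} x∈)))

  ∑𝟙*≡∣∣* : {P : Pred G 0ℓ} (P? : Decidable P) (c : ℕ) → ∑[ x ∈ elems ] (𝟙 (P? x) * c) ≡ ∣ P? ∣ * c
  ∑𝟙*≡∣∣* P? c = begin
    ∑[ x ∈ elems ] (𝟙 (P? x) * c) ≡⟨ ∑-cong elems (λ x → *-comm (𝟙 (P? x)) c) ⟩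
    ∑[ x ∈ elems ] (c * 𝟙 (P? x)) ≡⟨ ∑-*ˡ elems c (λ x → 𝟙 (P? x)) ⟩
    c * ∑[ x ∈ elems ] 𝟙 (P? x)   ≡⟨ cong (c *_) (∣∣≡∑𝟙 P?) ⟨
    c * ∣ P? ∣                    ≡⟨ *-comm c ∣ P? ∣ ⟩
    ∣ P? ∣ * c                    ∎
    where open ≡-Reasoning

  ∣≡∣≡1 : ∀ y → ∣ (_≟ y) ∣ ≡ 1
  ∣≡∣≡1 y = ≤-antisym (∣≡∣≤1 y) (∣∣>0 (_≟ y) refl)

  ∣∣≡∑-fibres : {I : Set} (is : List I) (_≟ᴵ_ : DecidableEquality I) (ι : G → I) →
                (∀ x → ∑[ i ∈ is ] 𝟙 (ι x ≟ᴵ i) ≡ 1) →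
                {Q : Pred G 0ℓ} (Q? : Decidable Q) → ∣ Q? ∣ ≡ ∑[ i ∈ is ] ∣ (λ x → Q? x ×-dec (ι x ≟ᴵ i)) ∣
  ∣∣≡∑-fibres is _≟ᴵ_ ι one-fibre Q? = begin
    ∣ Q? ∣                                                 ≡⟨ ∣∣≡∑𝟙 Q? ⟩
    ∑[ x ∈ elems ] 𝟙 (Q? x)                                ≡⟨ ∑-cong elems 𝟙≡∑-fibres ⟩
    ∑[ x ∈ elems ] (∑[ i ∈ is ] 𝟙 (Q? x ×-dec (ι x ≟ᴵ i))) ≡⟨ ∑-comm elems is _ ⟩
    ∑[ i ∈ is ] (∑[ x ∈ elems ] 𝟙 (Q? x ×-dec (ι x ≟ᴵ i))) ≡⟨ ∑-cong is (λ i → ∣∣≡∑𝟙 _) ⟨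
    ∑[ i ∈ is ] ∣ (λ x → Q? x ×-dec (ι x ≟ᴵ i)) ∣          ∎
    where
    open ≡-Reasoning
    𝟙≡∑-fibres : ∀ x → 𝟙 (Q? x) ≡ ∑[ i ∈ is ] 𝟙 (Q? x ×-dec (ι x ≟ᴵ i))
    𝟙≡∑-fibres x = begin
      𝟙 (Q? x)                               ≡⟨ *-identityʳ _ ⟨
      𝟙 (Q? x) * 1                           ≡⟨ cong (𝟙 (Q? x) *_) (one-fibre x) ⟨
      𝟙 (Q? x) * ∑[ i ∈ is ] 𝟙 (ι x ≟ᴵ i)    ≡⟨ ∑-*ˡ is (𝟙 (Q? x)) (λ i → 𝟙 (ι x ≟ᴵ i)) ⟨
      ∑[ i ∈ is ] (𝟙 (Q? x) * 𝟙 (ι x ≟ᴵ i))  ≡⟨ ∑-cong is (λ i → 𝟙-× (Q? x) (ι x ≟ᴵ i)) ⟨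
      ∑[ i ∈ is ] 𝟙 (Q? x ×-dec (ι x ≟ᴵ i))  ∎

  module _ {P : Pred G 0ℓ} (P? : Decidable P) (y : G) where

    ∣∣≤1+∣∖[]∣ : ∣ P? ∣ ≤ suc ∣ P? ∖[ y ] ∣
    ∣∣≤1+∣∖[]∣ = begin
      ∣ P? ∣                                         ≡⟨ ∣∣-split P? (_≟ y) ⟩
      ∣ (λ x → P? x ×-dec (x ≟ y)) ∣ + ∣ P? ∖[ y ] ∣
        ≤⟨ +-monoˡ-≤ _ (≤-trans (∣∣-mono _ (_≟ y) proj₂) (∣≡∣≤1 y)) ⟩
      suc ∣ P? ∖[ y ] ∣                              ∎
      where open ≤-Reasoning

    1+∣∖[]∣≤∣∣ : P y → suc ∣ P? ∖[ y ] ∣ ≤ ∣ P? ∣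
    1+∣∖[]∣≤∣∣ py = begin
      suc ∣ P? ∖[ y ] ∣
        ≤⟨ +-monoˡ-≤ _ (∣∣>0 (λ x → P? x ×-dec (x ≟ y)) (py , refl)) ⟩
      ∣ (λ x → P? x ×-dec (x ≟ y)) ∣ + ∣ P? ∖[ y ] ∣ ≡⟨ ∣∣-split P? (_≟ y) ⟨
      ∣ P? ∣                                         ∎
      where open ≤-Reasoning

-- The Cauchy–Davenport inequality, via Dyson's e-transform

module CauchyDavenport
  {G : Set} {op : Op₂ G} {unit : G} {inv : Op₁ G} (isAbelianGroup : IsAbelianGroup _≡_ op unit inv)
  (_≟_ : DecidableEquality G) (elems : List G) (∈-elems : ∀ x → x ∈ elems) (elems! : Unique elems)
  where

  abelianGroup : AbelianGroup 0ℓ 0ℓ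
  abelianGroup = record { isAbelianGroup = isAbelianGroup }

  open AbelianGroup abelianGroup using (_∙_; ε; _⁻¹; comm; identityʳ; rawMonoid; commutativeSemigroup)
  open import Algebra.Properties.AbelianGroup abelianGroup
    using (∙-cancelˡ; ∙-cancelʳ; //-rightDividesˡ; //-rightDividesʳ; x∙y⁻¹≈ε⇒x≈y)
  open import Algebra.Properties.CommutativeSemigroup commutativeSemigroup using (x∙yz≈y∙xz; x∙yz≈xz∙y)
  open import Algebra.Definitions.RawMonoid rawMonoid using () renaming (_×_ to _·_)
  open Counting _≟_ elems ∈-elems elems!

  _⊕_ : Pred G 0ℓ → Pred G 0ℓ → Pred G 0ℓ
  (X ⊕ Y) z = ∃[ x ] (X x × ∃[ y ] (Y y × x ∙ y ≡ z))

  _⊕?_ : {X Y : Pred G 0ℓ} → Decidable X → Decidable Y → Decidable (X ⊕ Y)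
  (X? ⊕? Y?) z = ∃? (λ x → X? x ×-dec ∃? (λ y → Y? y ×-dec ((x ∙ y) ≟ z)))

  ∣∣-translate : {P : Pred G 0ℓ} (P? : Decidable P) (g : G) → ∣ P? ∣ ≡ ∣ (λ x → P? (x ∙ g)) ∣
  ∣∣-translate {P} P? g = ≤-antisym
    (∣∣-injection P? (λ x → P? (x ∙ g)) (_∙ g ⁻¹) (∙-cancelʳ (g ⁻¹) _ _) (subst P (sym (//-rightDividesˡ g _))))
    (∣∣-injection (λ x → P? (x ∙ g)) P? (_∙ g) (∙-cancelʳ g _ _) (λ px → px))

  ∣∣≤∣⊕∣ : {X Y : Pred G 0ℓ} (X? : Decidable X) (Y? : Decidable Y) → ∀ {y} → Y y → ∣ X? ∣ ≤ ∣ X? ⊕? Y? ∣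
  ∣∣≤∣⊕∣ X? Y? {y} Yy = ∣∣-injection X? (X? ⊕? Y?) (_∙ y) (∙-cancelʳ y _ _) (λ {x} Xx → x , Xx , y , Yy , refl)

  module Transform {X Y : Pred G 0ℓ} (X? : Decidable X) (Y? : Decidable Y) (g : G) where

    Xᵍ : Pred G 0ℓ
    Xᵍ z = X z ⊎ Y (z ∙ g ⁻¹)

    Xᵍ? : Decidable Xᵍ
    Xᵍ? z = X? z ⊎-dec Y? (z ∙ g ⁻¹)

    Yᵍ : Pred G 0ℓ
    Yᵍ y = Y y × X (y ∙ g)

    Yᵍ? : Decidable Yᵍ
    Yᵍ? y = Y? y ×-dec X? (y ∙ g)

    ∣Xᵍ∣+∣Yᵍ∣≡∣X∣+∣Y∣ : ∣ Xᵍ? ∣ + ∣ Yᵍ? ∣ ≡ ∣ X? ∣ + ∣ Y? ∣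
    ∣Xᵍ∣+∣Yᵍ∣≡∣X∣+∣Y∣ = begin
      ∣ Xᵍ? ∣ + ∣ Yᵍ? ∣                         ≡⟨ cong (_+ ∣ Yᵍ? ∣) (∣∣-split Xᵍ? X?) ⟩
      ∣ Xᵍ∩X? ∣ + ∣ Xᵍ∖X? ∣ + ∣ Yᵍ? ∣          ≡⟨ cong₂ (λ m n → m + n + ∣ Yᵍ? ∣) ∣Xᵍ∩X∣≡∣X∣ ∣Xᵍ∖X∣≡∣Y∖Yᵍ∣ ⟩
      ∣ X? ∣ + ∣ Y∖Yᵍ? ∣ + ∣ Yᵍ? ∣              ≡⟨ +-assoc ∣ X? ∣ _ _ ⟩
      ∣ X? ∣ + (∣ Y∖Yᵍ? ∣ + ∣ Yᵍ? ∣)            ≡⟨ cong (∣ X? ∣ +_) (+-comm ∣ Y∖Yᵍ? ∣ _) ⟩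
      ∣ X? ∣ + (∣ Yᵍ? ∣ + ∣ Y∖Yᵍ? ∣)            ≡⟨ cong (∣ X? ∣ +_) (∣∣-split Y? (λ y → X? (y ∙ g))) ⟨
      ∣ X? ∣ + ∣ Y? ∣                           ∎
      where
      open ≡-Reasoning
      Xᵍ∩X? = λ z → Xᵍ? z ×-dec X? z
      Xᵍ∖X? = λ z → Xᵍ? z ×-dec ¬? (X? z)
      Y∖Yᵍ? = λ y → Y? y ×-dec ¬? (X? (y ∙ g))
      ∣Xᵍ∩X∣≡∣X∣ : ∣ Xᵍ∩X? ∣ ≡ ∣ X? ∣
      ∣Xᵍ∩X∣≡∣X∣ = ∣∣-cong Xᵍ∩X? X? proj₂ (λ Xz → inj₁ Xz , Xz)
      ∣Xᵍ∖X∣≡∣Y∖Yᵍ∣ : ∣ Xᵍ∖X? ∣ ≡ ∣ Y∖Yᵍ? ∣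
      ∣Xᵍ∖X∣≡∣Y∖Yᵍ∣ = trans (∣∣-translate Xᵍ∖X? g) (∣∣-cong (λ y → Xᵍ∖X? (y ∙ g)) Y∖Yᵍ? to from)
        where
        to : ∀ {y} → Xᵍ (y ∙ g) × ¬ X (y ∙ g) → Y y × ¬ X (y ∙ g)
        to (inj₁ X[y∙g] , ¬X[y∙g]) = ⊥-elim (¬X[y∙g] X[y∙g])
        to (inj₂ Y[y∙g∙g⁻¹] , ¬X[y∙g]) = subst Y (//-rightDividesʳ g _) Y[y∙g∙g⁻¹] , ¬X[y∙g]
        from : ∀ {y} → Y y × ¬ X (y ∙ g) → Xᵍ (y ∙ g) × ¬ X (y ∙ g)
        from (Yy , ¬X[y∙g]) = inj₂ (subst Y (sym (//-rightDividesʳ g _)) Yy) , ¬X[y∙g]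

    Xᵍ⊕Yᵍ⊆X⊕Y : (Xᵍ ⊕ Yᵍ) ⊆ (X ⊕ Y)
    Xᵍ⊕Yᵍ⊆X⊕Y (x , inj₁ Xx , y , (Yy , _) , x∙y≡z) = x , Xx , y , Yy , x∙y≡z
    Xᵍ⊕Yᵍ⊆X⊕Y (x , inj₂ Y[x∙g⁻¹] , y , (_ , X[y∙g]) , x∙y≡z) =
      y ∙ g , X[y∙g] , x ∙ g ⁻¹ , Y[x∙g⁻¹] , trans (x∙yz≈y∙xz (y ∙ g) x (g ⁻¹))
        (trans (cong (x ∙_) (//-rightDividesʳ g y)) x∙y≡z)

  module _ (p : ℕ) (·-injective : ∀ {d} → d ≢ ε → ∀ {s t} → s < p → t < p → s · d ≡ t · d → s ≡ t) where

    p≤∣∣-if-closed : {X : Pred G 0ℓ} (X? : Decidable X) → ∀ {d x} → d ≢ ε → X x →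
                     (∀ {a} → X a → X (a ∙ d)) → p ≤ ∣ X? ∣
    p≤∣∣-if-closed {X} X? {d} {x} d≢ε Xx X+d⊆X = begin
      p                          ≡⟨ length-applyUpTo orbit p ⟨
      length (applyUpTo orbit p) ≤⟨ length≤∣∣ X? orbit! orbit⊆X ⟩
      ∣ X? ∣                     ∎
      where
      open ≤-Reasoning
      orbit : ℕ → G
      orbit t = x ∙ (t · d)
      orbit-in-X : ∀ t → X (orbit t)
      orbit-in-X zero    = subst X (sym (identityʳ x)) Xx
      orbit-in-X (suc t) = subst X (sym (x∙yz≈xz∙y x d (t · d))) (X+d⊆X (orbit-in-X t))
      orbit! : Unique (applyUpTo orbit p)
      orbit! = Unique.applyUpTo⁺₁ orbit p (λ s<t t<p eq →
                 <⇒≢ s<t (·-injective d≢ε (<-trans s<t t<p) t<p (∙-cancelˡ x _ _ eq)))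
      orbit⊆X : ∀ {z} → z ∈ applyUpTo orbit p → X z
      orbit⊆X z∈ with ∈-applyUpTo⁻ orbit z∈
      ... | t , _ , refl = orbit-in-X t

    module _ {X Y : Pred G 0ℓ} (X? : Decidable X) (Y? : Decidable Y) where

      cd-singleton : ∀ {b} → Y b → (∀ {y} → Y y → y ≡ b) → ∣ X? ∣ + ∣ Y? ∣ ≤ suc ∣ X? ⊕? Y? ∣
      cd-singleton {b} Yb Y⊆b = begin
        ∣ X? ∣ + ∣ Y? ∣ ≤⟨ +-monoʳ-≤ ∣ X? ∣ (≤-trans (∣∣-mono Y? (_≟ b) Y⊆b) (∣≡∣≤1 b)) ⟩
        ∣ X? ∣ + 1      ≡⟨ +-comm ∣ X? ∣ 1 ⟩
        suc ∣ X? ∣      ≤⟨ s≤s (∣∣≤∣⊕∣ X? Y? Yb) ⟩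
        suc ∣ X? ⊕? Y? ∣ ∎
        where open ≤-Reasoning

      cd-closed : ∀ {x b b′} → X x → Y b → Y b′ → b′ ≢ b →
                  (∀ {a} → X a → X (a ∙ (b′ ∙ b ⁻¹))) → suc (suc p) ≤ ∣ X? ∣ + ∣ Y? ∣
      cd-closed {b = b} Xx Yb Yb′ b′≢b X+d⊆X = begin
        suc (suc p)     ≡⟨ +-comm 2 p ⟩
        p + 2           ≤⟨ +-mono-≤ (p≤∣∣-if-closed X? (b′≢b ∘ x∙y⁻¹≈ε⇒x≈y _ _) Xx X+d⊆X) 2≤∣Y∣ ⟩
        ∣ X? ∣ + ∣ Y? ∣ ∎
        where
        open ≤-Reasoning
        2≤∣Y∣ : 2 ≤ ∣ Y? ∣
        2≤∣Y∣ = ≤-trans (s≤s (∣∣>0 (Y? ∖[ b ]) (Yb′ , b′≢b))) (1+∣∖[]∣≤∣∣ Y? b Yb)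

    cd-bounded : ∀ n {X Y : Pred G 0ℓ} (X? : Decidable X) (Y? : Decidable Y) → ∣ Y? ∣ ≤ n → ∃ X → ∃ Y →
                 ∣ X? ∣ + ∣ Y? ∣ ≤ suc p → ∣ X? ∣ + ∣ Y? ∣ ≤ suc ∣ X? ⊕? Y? ∣
    cd-bounded zero    X? Y? ∣Y∣≤0 _ (b , Yb) _ with () ← ≤-trans (∣∣>0 Y? Yb) ∣Y∣≤0
    cd-bounded (suc n) {X} {Y} X? Y? ∣Y∣≤1+n (x , Xx) (b , Yb) bound with ∃? (Y? ∖[ b ])
    ... | no ∄b′ = cd-singleton X? Y? Yb (λ {y} Yy → decidable-stable (y ≟ b) (λ y≢b → ∄b′ (y , Yy , y≢b)))
    ... | yes (b′ , Yb′ , b′≢b) with ∃? (λ a → X? a ×-dec ¬? (X? (a ∙ (b′ ∙ b ⁻¹))))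
    ...   | no ∄a = contradiction bound (<⇒≱ (cd-closed X? Y? Xx Yb Yb′ b′≢b
                      (λ {a} Xa → decidable-stable (X? _) (λ ¬Xa+d → ∄a (a , Xa , ¬Xa+d)))))
    ...   | yes (a , Xa , ¬Xa+d) = begin
      ∣ X? ∣ + ∣ Y? ∣           ≡⟨ ∣Xᵍ∣+∣Yᵍ∣≡∣X∣+∣Y∣ ⟨
      ∣ Xᵍ? ∣ + ∣ Yᵍ? ∣         ≤⟨ cd-bounded n Xᵍ? Yᵍ? ∣Yᵍ∣≤n (x , inj₁ Xx) (b , Yb , X[b∙g])
                                     (subst (_≤ suc p) (sym ∣Xᵍ∣+∣Yᵍ∣≡∣X∣+∣Y∣) bound) ⟩
      suc ∣ Xᵍ? ⊕? Yᵍ? ∣        ≤⟨ s≤s (∣∣-mono (Xᵍ? ⊕? Yᵍ?) (X? ⊕? Y?) Xᵍ⊕Yᵍ⊆X⊕Y) ⟩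
      suc ∣ X? ⊕? Y? ∣          ∎
      where
      open ≤-Reasoning
      g = a ∙ b ⁻¹
      open Transform X? Y? g
      -- b stays in Yᵍ since b ∙ g = a ∈ X, while b′ leaves it since b′ ∙ g = a ∙ (b′ ∙ b ⁻¹) ∉ X.
      X[b∙g] : X (b ∙ g)
      X[b∙g] = subst X (sym (trans (comm b g) (//-rightDividesˡ b a))) Xa
      Yᵍ⊆Y∖b′ : ∀ {y} → Yᵍ y → Y y × y ≢ b′
      Yᵍ⊆Y∖b′ (Yy , X[y∙g]) = Yy , λ { refl → ¬Xa+d (subst X (x∙yz≈y∙xz b′ a (b ⁻¹)) X[y∙g]) }
      ∣Yᵍ∣≤n : ∣ Yᵍ? ∣ ≤ n
      ∣Yᵍ∣≤n = ≤-pred (≤-trans (s≤s (∣∣-mono Yᵍ? (Y? ∖[ b′ ]) Yᵍ⊆Y∖b′))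
                               (≤-trans (1+∣∖[]∣≤∣∣ Y? b′ Yb′) ∣Y∣≤1+n))

    cauchy-davenport : {X Y : Pred G 0ℓ} (X? : Decidable X) (Y? : Decidable Y) → ∃ X → ∃ Y →
                       ∣ X? ∣ + ∣ Y? ∣ ≤ suc p → ∣ X? ∣ + ∣ Y? ∣ ≤ suc ∣ X? ⊕? Y? ∣
    cauchy-davenport X? Y? = cd-bounded ∣ Y? ∣ X? Y? ≤-refl

isAbelianGroup-≡ : {A : Set} {_∙_ : Op₂ A} {ε : A} {_⁻¹ : Op₁ A} →
                   (∀ x y z → (x ∙ y) ∙ z ≡ x ∙ (y ∙ z)) → (∀ x y → x ∙ y ≡ y ∙ x) →
                   (∀ x → x ∙ ε ≡ x) → (∀ x → x ∙ (x ⁻¹) ≡ ε) → IsAbelianGroup _≡_ _∙_ ε _⁻¹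
isAbelianGroup-≡ {_⁻¹ = _⁻¹} assoc comm identityʳ inverseʳ = record
  { isGroup = record
    { isMonoid = record
      { isSemigroup = record
        { isMagma = record { isEquivalence = isEquivalence ; ∙-cong = cong₂ _ }
        ; assoc = assoc
        }
      ; identity = comm∧idʳ⇒id comm identityʳ
      }
    ; inverse = comm∧invʳ⇒inv comm inverseʳ
    ; ⁻¹-cong = cong _⁻¹
    }
  ; comm = comm
  }

m%d≡n%d⇒d∣n∸m : ∀ m n d .{{_ : NonZero d}} → m % d ≡ n % d → d ∣ n ∸ m
m%d≡n%d⇒d∣n∸m m n d m%d≡n%d = divides (n / d ∸ m / d) (begin
  n ∸ m                                      ≡⟨ cong₂ _∸_ (m≡m%n+[m/n]*n n d) (m≡m%n+[m/n]*n m d) ⟩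
  (n % d + n / d * d) ∸ (m % d + m / d * d)  ≡⟨ cong (λ r → (n % d + n / d * d) ∸ (r + m / d * d)) m%d≡n%d ⟩
  (n % d + n / d * d) ∸ (n % d + m / d * d)  ≡⟨ [m+n]∸[m+o]≡n∸o (n % d) _ _ ⟩
  n / d * d ∸ m / d * d                      ≡⟨ *-distribʳ-∸ d (n / d) (m / d) ⟨
  (n / d ∸ m / d) * d                        ∎)
  where open ≡-Reasoning

[m%d+n]%d≡[m+n]%d : ∀ m n d .{{_ : NonZero d}} → (m % d + n) % d ≡ (m + n) % d
[m%d+n]%d≡[m+n]%d m n d = begin
  (m % d + n) % d         ≡⟨ %-distribˡ-+ (m % d) n d ⟩
  (m % d % d + n % d) % d ≡⟨ cong (λ r → (r + n % d) % d) (m%n%n≡m%n m d) ⟩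
  (m % d + n % d) % d     ≡⟨ %-distribˡ-+ m n d ⟨
  (m + n) % d             ∎
  where open ≡-Reasoning

[m+n%d]%d≡[m+n]%d : ∀ m n d .{{_ : NonZero d}} → (m + n % d) % d ≡ (m + n) % d
[m+n%d]%d≡[m+n]%d m n d = begin
  (m + n % d) % d ≡⟨ cong (_% d) (+-comm m (n % d)) ⟩
  (n % d + m) % d ≡⟨ [m%d+n]%d≡[m+n]%d n m d ⟩
  (n + m) % d     ≡⟨ cong (_% d) (+-comm n m) ⟩
  (m + n) % d     ∎
  where open ≡-Reasoning

module ℤₚ (k : ℕ) where

  p : ℕ
  p = suc k

  toℕ-addℤ : ∀ x y → toℕ (addℤ p x y) ≡ (toℕ x + toℕ y) % p
  toℕ-addℤ x y = toℕ-fromℕ< _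

  addℤ-comm : ∀ x y → addℤ p x y ≡ addℤ p y x
  addℤ-comm x y = cong (_mod p) (+-comm (toℕ x) (toℕ y))

  addℤ-assoc : ∀ x y z → addℤ p (addℤ p x y) z ≡ addℤ p x (addℤ p y z)
  addℤ-assoc x y z = toℕ-injective (begin
    toℕ (addℤ p (addℤ p x y) z)    ≡⟨ toℕ-addℤ (addℤ p x y) z ⟩
    (toℕ (addℤ p x y) + toℕ z) % p ≡⟨ cong (λ r → (r + toℕ z) % p) (toℕ-addℤ x y) ⟩
    ((toℕ x + toℕ y) % p + toℕ z) % p ≡⟨ [m%d+n]%d≡[m+n]%d (toℕ x + toℕ y) (toℕ z) p ⟩
    (toℕ x + toℕ y + toℕ z) % p    ≡⟨ cong (_% p) (+-assoc (toℕ x) (toℕ y) (toℕ z)) ⟩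
    (toℕ x + (toℕ y + toℕ z)) % p  ≡⟨ [m+n%d]%d≡[m+n]%d (toℕ x) (toℕ y + toℕ z) p ⟨
    (toℕ x + (toℕ y + toℕ z) % p) % p ≡⟨ cong (λ r → (toℕ x + r) % p) (toℕ-addℤ y z) ⟨
    (toℕ x + toℕ (addℤ p y z)) % p ≡⟨ toℕ-addℤ x (addℤ p y z) ⟨
    toℕ (addℤ p x (addℤ p y z))    ∎)
    where open ≡-Reasoning

  addℤ-identityʳ : ∀ x → addℤ p x fzero ≡ x
  addℤ-identityʳ x = toℕ-injective (begin
    toℕ (addℤ p x fzero) ≡⟨ toℕ-addℤ x fzero ⟩
    (toℕ x + 0) % p      ≡⟨ cong (_% p) (+-identityʳ (toℕ x)) ⟩
    toℕ x % p            ≡⟨ m<n⇒m%n≡m (toℕ<n x) ⟩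
    toℕ x                ∎)
    where open ≡-Reasoning

  addℤ-inverseʳ : ∀ x → addℤ p x (negℤ p x) ≡ fzero
  addℤ-inverseʳ x = toℕ-injective (begin
    toℕ (addℤ p x (negℤ p x))      ≡⟨ toℕ-addℤ x (negℤ p x) ⟩
    (toℕ x + toℕ (negℤ p x)) % p   ≡⟨ cong (λ r → (toℕ x + r) % p) (toℕ-fromℕ< _) ⟩
    (toℕ x + (p ∸ toℕ x) % p) % p  ≡⟨ [m+n%d]%d≡[m+n]%d (toℕ x) (p ∸ toℕ x) p ⟩
    (toℕ x + (p ∸ toℕ x)) % p      ≡⟨ cong (_% p) (m+[n∸m]≡n (<⇒≤ (toℕ<n x))) ⟩
    p % p                          ≡⟨ n%n≡0 p ⟩
    0                              ∎)
    where open ≡-Reasoning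

  isAbelianGroup : IsAbelianGroup _≡_ (addℤ p) fzero (negℤ p)
  isAbelianGroup = isAbelianGroup-≡ addℤ-assoc addℤ-comm addℤ-identityʳ addℤ-inverseʳ

  abelianGroup : AbelianGroup 0ℓ 0ℓ
  abelianGroup = record { isAbelianGroup = isAbelianGroup }

  open import Algebra.Definitions.RawMonoid (AbelianGroup.rawMonoid abelianGroup) using () renaming (_×_ to _·_)

  toℕ-· : ∀ t d → toℕ (t · d) ≡ (t * toℕ d) % p
  toℕ-· zero    d = refl
  toℕ-· (suc t) d = begin
    toℕ (addℤ p d (t · d))          ≡⟨ toℕ-addℤ d (t · d) ⟩
    (toℕ d + toℕ (t · d)) % p       ≡⟨ cong (λ r → (toℕ d + r) % p) (toℕ-· t d) ⟩
    (toℕ d + (t * toℕ d) % p) % p   ≡⟨ [m+n%d]%d≡[m+n]%d (toℕ d) (t * toℕ d) p ⟩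
    (toℕ d + t * toℕ d) % p         ∎
    where open ≡-Reasoning

  module _ (p-prime : Prime p) where

    ·-distinct : ∀ {d s t} → d ≢ fzero → s < t → t < p → s · d ≢ t · d
    ·-distinct {d} {s} {t} d≢0 s<t t<p s·d≡t·d with euclidsLemma (t ∸ s) (toℕ d) p-prime p∣[t∸s]*d
      where
      p∣[t∸s]*d : p ∣ (t ∸ s) * toℕ d
      p∣[t∸s]*d = subst (p ∣_) (sym (*-distribʳ-∸ (toℕ d) t s))
        (m%d≡n%d⇒d∣n∸m (s * toℕ d) (t * toℕ d) p
          (trans (sym (toℕ-· s d)) (trans (cong toℕ s·d≡t·d) (toℕ-· t d))))
    ... | inj₁ p∣t∸s = >⇒∤ {{>-nonZero (m<n⇒0<n∸m s<t)}} (≤-<-trans (m∸n≤m t s) t<p) p∣t∸s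
    ... | inj₂ p∣d   = >⇒∤ {{>-nonZero (n≢0⇒n>0 (d≢0 ∘ toℕ-injective))}} (toℕ<n d) p∣d

    ·-injective : ∀ {d} → d ≢ fzero → ∀ {s t} → s < p → t < p → s · d ≡ t · d → s ≡ t
    ·-injective d≢0 {s} {t} s<p t<p s·d≡t·d with <-cmp s t
    ... | tri< s<t _ _ = ⊥-elim (·-distinct d≢0 s<t t<p s·d≡t·d)
    ... | tri≈ _ s≡t _ = s≡t
    ... | tri> _ _ t<s = ⊥-elim (·-distinct d≢0 t<s s<p (sym s·d≡t·d))

  isAbelianGroup² : IsAbelianGroup _≡_ (add² p) (zero² p) (neg² p)
  isAbelianGroup² = isAbelianGroup-≡
    (λ (a , b) (c , d) (e , f) → cong₂ _,_ (addℤ-assoc a c e) (addℤ-assoc b d f))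
    (λ (a , b) (c , d) → cong₂ _,_ (addℤ-comm a c) (addℤ-comm b d))
    (λ (a , b) → cong₂ _,_ (addℤ-identityʳ a) (addℤ-identityʳ b))
    (λ (a , b) → cong₂ _,_ (addℤ-inverseʳ a) (addℤ-inverseʳ b))

  ∈-allℤ² : ∀ x → x ∈ allℤ² p
  ∈-allℤ² (a , b) = ∈-cartesianProduct⁺ (∈-allFin a) (∈-allFin b)

  allℤ²! : Unique (allℤ² p)
  allℤ²! = Unique.cartesianProduct⁺ (Unique.allFin⁺ p) (Unique.allFin⁺ p)

  abelianGroup² : AbelianGroup 0ℓ 0ℓ
  abelianGroup² = record { isAbelianGroup = isAbelianGroup² }

  open import Algebra.Definitions.RawMonoid (AbelianGroup.rawMonoid abelianGroup²) using () renaming (_×_ to _·²_)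

  ·²-componentwise : ∀ t a b → t ·² (a , b) ≡ (t · a , t · b)
  ·²-componentwise zero    a b = refl
  ·²-componentwise (suc t) a b = cong (add² p (a , b)) (·²-componentwise t a b)

  ·²-injective : Prime p → ∀ {d} → d ≢ zero² p → ∀ {s t} → s < p → t < p → s ·² d ≡ t ·² d → s ≡ t
  ·²-injective p-prime {a , b} d≢0 {s} {t} s<p t<p s·d≡t·d with a ≟ fzero | b ≟ fzero
  ... | yes refl | yes refl = ⊥-elim (d≢0 refl)
  ... | no a≢0   | _        = ·-injective p-prime a≢0 s<p t<p (cong proj₁ componentwise)
    where componentwise = trans (sym (·²-componentwise s a b)) (trans s·d≡t·d (·²-componentwise t a b))
  ... | _        | no b≢0   = ·-injective p-prime b≢0 s<p t<p (cong proj₂ componentwise)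
    where componentwise = trans (sym (·²-componentwise s a b)) (trans s·d≡t·d (·²-componentwise t a b))

m≤1+n⇒m∸1≤n : ∀ {m n} → m ≤ suc n → m ∸ 1 ≤ n
m≤1+n⇒m∸1≤n = ∸-monoˡ-≤ 1

sizes⇒4≤a₀ : ∀ k a₀ m → 1 ≤ k → 2 * suc k + 1 ≤ a₀ + m * a₀ → 2 * m ≤ k → 4 ≤ a₀
sizes⇒4≤a₀ k a₀ m 1≤k 2p+1≤ 2m≤k with 4 ≤? a₀
... | yes 4≤a₀ = 4≤a₀
... | no  4≰a₀ = contradiction (begin
  3 * k + 6 + k       ≡⟨ solve (k ∷ []) ⟩
  2 * (2 * suc k + 1) ≤⟨ *-monoʳ-≤ 2 2p+1≤ ⟩
  2 * (a₀ + m * a₀)   ≤⟨ *-monoʳ-≤ 2 (+-mono-≤ a₀≤3 (*-monoʳ-≤ m a₀≤3)) ⟩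
  2 * (3 + m * 3)     ≡⟨ solve (m ∷ []) ⟩
  6 + 3 * (2 * m)     ≤⟨ +-monoʳ-≤ 6 (*-monoʳ-≤ 3 2m≤k) ⟩
  6 + 3 * k           ≡⟨ +-comm 6 (3 * k) ⟩
  3 * k + 6           ∎) (<⇒≱ (m<m+n (3 * k + 6) 1≤k))
  where
  open ≤-Reasoning
  a₀≤3 : a₀ ≤ 3
  a₀≤3 = ≤-pred (≰⇒> 4≰a₀)

sizes⇒3≤m : ∀ k a₀ m → 1 ≤ k → 2 * suc k + 1 ≤ a₀ + m * a₀ → 2 * a₀ ≤ suc k + 1 → 3 ≤ m
sizes⇒3≤m k a₀ m 1≤k 2p+1≤ 2a₀≤p+1 with 3 ≤? m
... | yes 3≤m = 3≤m
... | no  3≰m = contradiction (begin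
  3 * k + 6 + k       ≡⟨ solve (k ∷ []) ⟩
  2 * (2 * suc k + 1) ≤⟨ *-monoʳ-≤ 2 2p+1≤ ⟩
  2 * (a₀ + m * a₀)   ≤⟨ *-monoʳ-≤ 2 (+-monoʳ-≤ a₀ (*-monoˡ-≤ a₀ m≤2)) ⟩
  2 * (a₀ + 2 * a₀)   ≡⟨ solve (a₀ ∷ []) ⟩
  3 * (2 * a₀)        ≤⟨ *-monoʳ-≤ 3 2a₀≤p+1 ⟩
  3 * (suc k + 1)     ≡⟨ solve (k ∷ []) ⟩
  3 * k + 6           ∎) (<⇒≱ (m<m+n (3 * k + 6) 1≤k))
  where
  open ≤-Reasoning
  m≤2 : m ≤ 2
  m≤2 = ≤-pred (≰⇒> 3≰m)

restricted-sumset-bound : ∀ k a₀ m s′ L F T → 4 ≤ a₀ → 3 ≤ m → a₀ + s′ ≡ 2 * suc k + 1 → L + m ≡ s′ →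
                          L ≤ (a₀ ∸ 1) + F → (a₀ ∸ 1) + (m * (a₀ ∸ 1) + s′) + F ≤ T → 4 * suc k ≤ T
restricted-sumset-bound k a₀@(suc (suc (suc (suc c)))) m@(suc (suc (suc n))) s′ L F T
                        (s≤s (s≤s (s≤s (s≤s _)))) (s≤s (s≤s (s≤s _))) a₀+s′≡2p+1 L+m≡s′ L≤K+F lower≤T =
  +-cancelʳ-≤ m (4 * suc k) T (begin
    4 * suc k + m                                  ≡⟨ cong (_+ m) 4p≡6+2c+2s′ ⟩
    6 + 2 * c + 2 * s′ + m                         ≤⟨ m≤m+n _ (c + 2 * n + n * c) ⟩
    6 + 2 * c + 2 * s′ + m + (c + 2 * n + n * c)   ≡⟨ expand c n s′ ⟩
    m * K + s′ + s′                                ≡⟨ cong (m * K + s′ +_) L+m≡s′ ⟨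
    m * K + s′ + (L + m)                           ≤⟨ +-monoʳ-≤ (m * K + s′) (+-monoˡ-≤ m L≤K+F) ⟩
    m * K + s′ + (K + F + m)                       ≡⟨ x+y+[z+w+v]≡z+[x+y]+w+v (m * K) s′ K F m ⟩
    K + (m * K + s′) + F + m                       ≤⟨ +-monoˡ-≤ m lower≤T ⟩
    T + m                                          ∎)
  where
  open ≤-Reasoning
  K = 3 + c
  x+y+[z+w+v]≡z+[x+y]+w+v : ∀ x y z w v → x + y + (z + w + v) ≡ z + (x + y) + w + v
  x+y+[z+w+v]≡z+[x+y]+w+v = solve-∀
  expand : ∀ c n s → 6 + 2 * c + 2 * s + (3 + n) + (c + 2 * n + n * c) ≡ (3 + n) * (3 + c) + s + s
  expand = solve-∀
  4p≡6+2c+2s′ : 4 * suc k ≡ 6 + 2 * c + 2 * s′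
  4p≡6+2c+2s′ = +-cancelʳ-≡ 2 _ _ (begin-equality
    4 * suc k + 2               ≡⟨ solve (k ∷ []) ⟩
    2 * (2 * suc k + 1)         ≡⟨ cong (2 *_) a₀+s′≡2p+1 ⟨
    2 * (a₀ + s′)               ≡⟨ solve (c ∷ s′ ∷ []) ⟩
    6 + 2 * c + 2 * s′ + 2      ∎)

-- Restricted sums coset by coset

module CosetCounting (k : ℕ) (p-prime : Prime (suc k)) {A : Pred (ℤ² (suc k)) 0ℓ} (A? : Decidable A)
                     (ι : ℤ² (suc k) → ℤ (suc k))
                     (ι-additive : ∀ x y → ι (add² (suc k) x y) ≡ addℤ (suc k) (ι x) (ι y)) where

  open ℤₚ k
  open Counting _≟_ (allFin p) ∈-allFin (Unique.allFin⁺ p)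
  open CauchyDavenport isAbelianGroup _≟_ (allFin p) ∈-allFin (Unique.allFin⁺ p)
    using (_⊕_; _⊕?_; cauchy-davenport)
  module C² = Counting _≟²_ (allℤ² p) ∈-allℤ² allℤ²!
  open C² using () renaming (∣_∣ to ∣_∣²)
  module CD² = CauchyDavenport isAbelianGroup² _≟²_ (allℤ² p) ∈-allℤ² allℤ²!
  open import Algebra.Properties.AbelianGroup CD².abelianGroup using (∙-cancelʳ)

  fins : List (Fin p)
  fins = allFin p

  A[_] : Fin p → Pred (ℤ² p) 0ℓ
  A[ i ] x = A x × ι x ≡ i

  A[_]? : (i : Fin p) → Decidable A[ i ]
  A[_]? = Aᵢ? p A? ι

  -- a, m and ∣ Â? ∣² unfold to cardAᵢ, nonEmptyCosetCount and cardRestrictedSumset.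
  a : Fin p → ℕ
  a = cardAᵢ p A? ι

  a₀ K : ℕ
  a₀ = a fzero
  K  = a₀ ∸ 1

  Â : Pred (ℤ² p) 0ℓ
  Â = InRestrictedSumset p A

  Â? : Decidable Â
  Â? = InRestrictedSumset? p A?

  r : Fin p → ℕ
  r i = ∣ (λ z → Â? z ×-dec (ι z ≟ i)) ∣²

  Support Occupied : Pred (Fin p) 0ℓ
  Support i  = 1 ≤ a i
  Occupied i = i ≢ fzero × Support i

  support? : Decidable Support
  support? i = 1 ≤? a i

  occupied? : Decidable Occupied
  occupied? i = ¬? (i ≟ fzero) ×-dec support? i

  m s′ : ℕ
  m  = ∣ occupied? ∣
  s′ = ∑[ i ∈ fins ] (𝟙 (occupied? i) * a i)

  ∣∣²≡∑-cosets : {Q : Pred (ℤ² p) 0ℓ} (Q? : Decidable Q) →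
                 ∣ Q? ∣² ≡ ∑[ i ∈ fins ] ∣ (λ z → Q? z ×-dec (ι z ≟ i)) ∣²
  ∣∣²≡∑-cosets = C².∣∣≡∑-fibres fins _≟_ ι (λ z → begin
    ∑[ i ∈ fins ] 𝟙 (ι z ≟ i) ≡⟨ ∣∣≡∑𝟙 (ι z ≟_) ⟨
    ∣ (ι z ≟_) ∣              ≡⟨ ∣∣-cong (ι z ≟_) (_≟ ι z) sym sym ⟩
    ∣ (_≟ ι z) ∣              ≡⟨ ∣≡∣≡1 (ι z) ⟩
    1                         ∎)
    where open ≡-Reasoning

  a≤1+r : ∀ j {y} → A y → a j ≤ suc (r (addℤ p j (ι y)))
  a≤1+r j {y} Ay = ≤-trans (C².∣∣≤1+∣∖[]∣ A[ j ]? y)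
    (s≤s (C².∣∣-injection (A[ j ]? C².∖[ y ]) (λ z → Â? z ×-dec (ι z ≟ addℤ p j (ι y)))
                          (λ x → add² p x y) (∙-cancelʳ y _ _)
      (λ {x} ((Ax , ιx≡j) , x≢y) → (x , y , Ax , Ay , x≢y , refl) ,
                                   trans (ι-additive x y) (cong (λ i → addℤ p i (ι y)) ιx≡j))))

  K≤r₀ : 1 ≤ a₀ → K ≤ r fzero
  K≤r₀ 1≤a₀ =
    let y , Ay , ιy≡0 = C².∣∣>0⇒∃ A[ fzero ]? 1≤a₀
        0+ιy≡0 = trans (cong (addℤ p fzero) ιy≡0) (addℤ-identityʳ fzero)
    in m≤1+n⇒m∸1≤n {a₀} {r fzero} (subst (λ i → a₀ ≤ suc (r i)) 0+ιy≡0 (a≤1+r fzero Ay))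

  A₀⊕Aᵢ⊆Âᵢ : ∀ {i} → i ≢ fzero →
              (A[ fzero ] CD².⊕ A[ i ]) ⊆ (λ z → Â z × ι z ≡ i)
  A₀⊕Aᵢ⊆Âᵢ {i} i≢0 (x , (Ax , ιx≡0) , y , (Ay , ιy≡i) , x+y≡z) =
    (x , y , Ax , Ay , x≢y , x+y≡z) , (begin
      ι _                    ≡⟨ cong ι x+y≡z ⟨
      ι (add² p x y)         ≡⟨ ι-additive x y ⟩
      addℤ p (ι x) (ι y)     ≡⟨ cong₂ (addℤ p) ιx≡0 ιy≡i ⟩
      addℤ p fzero i         ≡⟨ addℤ-comm fzero i ⟩
      addℤ p i fzero         ≡⟨ addℤ-identityʳ i ⟩
      i                      ∎)
    where
    open ≡-Reasoning
    x≢y : x ≢ y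
    x≢y refl = i≢0 (trans (sym ιy≡i) ιx≡0)

  Level Fresh : ℕ → Pred (Fin p) 0ℓ
  Level t j = Occupied j × suc t ≤ a j ∸ 1
  Fresh t i = (Level t ⊕ Support) i × ¬ Support i

  level? : (t : ℕ) → Decidable (Level t)
  level? t j = occupied? j ×-dec (suc t ≤? a j ∸ 1)

  fresh? : (t : ℕ) → Decidable (Fresh t)
  fresh? t i = (level? t ⊕? support?) i ×-dec ¬? (support? i)

  freshness : Fin p → ℕ
  freshness i = ∑[ t ∈ downFrom K ] 𝟙 (fresh? t i)

  freshness≤r : ∀ i → freshness i ≤ r i
  freshness≤r i = ∑𝟙-downFrom≤ K (λ t → fresh? t i) t<r
    where
    t<r : ∀ t → Fresh t i → suc t ≤ r i
    t<r t ((j , (_ , t<aⱼ∸1) , l , 1≤aₗ , j+l≡i) , _) =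
      let y , Ay , ιy≡l = C².∣∣>0⇒∃ A[ l ]? 1≤aₗ
          j+ιy≡i = trans (cong (addℤ p j) ιy≡l) j+l≡i
      in ≤-trans t<aⱼ∸1 (m≤1+n⇒m∸1≤n {a j} {r i} (subst (λ i → a j ≤ suc (r i)) j+ιy≡i (a≤1+r j Ay)))

  freshness≡0 : ∀ {i} → 1 ≤ a i → freshness i ≡ 0
  freshness≡0 {i} 1≤aᵢ = trans (∑-cong (downFrom K) (λ t → 𝟙-no (fresh? t i) (λ (_ , ¬1≤aᵢ) → ¬1≤aᵢ 1≤aᵢ)))
                               (∑-zero (downFrom K))

  F : ℕ
  F = ∑[ t ∈ downFrom K ] ∣ fresh? t ∣

  ∑freshness≡F : ∑[ i ∈ fins ] freshness i ≡ F
  ∑freshness≡F = trans (∑-comm fins (downFrom K) (λ i t → 𝟙 (fresh? t i)))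
                       (∑-cong (downFrom K) (λ t → sym (∣∣≡∑𝟙 (fresh? t))))

  ∑δ₀ : ∀ c → ∑[ i ∈ fins ] (𝟙 (i ≟ fzero) * c) ≡ c
  ∑δ₀ c = trans (∑𝟙*≡∣∣* (_≟ fzero) c) (trans (cong (_* c) (∣≡∣≡1 fzero)) (*-identityˡ c))

  lower : Fin p → ℕ
  lower i = 𝟙 (i ≟ fzero) * K + 𝟙 (occupied? i) * (K + a i) + freshness i

  ∑lower≡ : ∑[ i ∈ fins ] lower i ≡ K + (m * K + s′) + F
  ∑lower≡ = begin
    ∑[ i ∈ fins ] lower i
      ≡⟨ ∑-distrib-+ fins (λ i → 𝟙 (i ≟ fzero) * K + 𝟙 (occupied? i) * (K + a i)) freshness ⟩
    ∑[ i ∈ fins ] (𝟙 (i ≟ fzero) * K + 𝟙 (occupied? i) * (K + a i)) + ∑[ i ∈ fins ] freshness i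
      ≡⟨ cong₂ _+_ (∑-distrib-+ fins (λ i → 𝟙 (i ≟ fzero) * K) (λ i → 𝟙 (occupied? i) * (K + a i)))
                   ∑freshness≡F ⟩
    ∑[ i ∈ fins ] (𝟙 (i ≟ fzero) * K) + ∑[ i ∈ fins ] (𝟙 (occupied? i) * (K + a i)) + F
      ≡⟨ cong₂ (λ u v → u + v + F) (∑δ₀ K) ∑occ[K+a] ⟩
    K + (m * K + s′) + F
      ∎
    where
    open ≡-Reasoning
    ∑occ[K+a] : ∑[ i ∈ fins ] (𝟙 (occupied? i) * (K + a i)) ≡ m * K + s′
    ∑occ[K+a] = begin
      ∑[ i ∈ fins ] (𝟙 (occupied? i) * (K + a i))
        ≡⟨ ∑-cong fins (λ i → *-distribˡ-+ (𝟙 (occupied? i)) K (a i)) ⟩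
      ∑[ i ∈ fins ] (𝟙 (occupied? i) * K + 𝟙 (occupied? i) * a i)
        ≡⟨ ∑-distrib-+ fins (λ i → 𝟙 (occupied? i) * K) (λ i → 𝟙 (occupied? i) * a i) ⟩
      ∑[ i ∈ fins ] (𝟙 (occupied? i) * K) + s′
        ≡⟨ cong (_+ s′) (∑𝟙*≡∣∣* occupied? K) ⟩
      m * K + s′
        ∎

  module _ (a≤a₀ : ∀ i → a i ≤ a₀) (2a₀≤p+1 : 2 * a₀ ≤ p + 1) (1≤a₀ : 1 ≤ a₀) where

    K+a≤r : ∀ {i} → i ≢ fzero → 1 ≤ a i → K + a i ≤ r i
    K+a≤r {i} i≢0 1≤aᵢ = begin
      K + a i              ≡⟨ +-∸-comm (a i) 1≤a₀ ⟨
      a₀ + a i ∸ 1         ≤⟨ ∸-monoˡ-≤ 1 (≤-trans cauchy-davenport-A₀Aᵢ (s≤s ∣A₀⊕Aᵢ∣≤r)) ⟩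
      r i                  ∎
      where
      open ≤-Reasoning
      a₀+aᵢ≤1+p : a₀ + a i ≤ suc p
      a₀+aᵢ≤1+p = begin
        a₀ + a i      ≤⟨ +-monoʳ-≤ a₀ (a≤a₀ i) ⟩
        a₀ + a₀       ≡⟨ cong (a₀ +_) (+-identityʳ a₀) ⟨
        2 * a₀        ≤⟨ 2a₀≤p+1 ⟩
        p + 1         ≡⟨ +-comm p 1 ⟩
        suc p         ∎
      cauchy-davenport-A₀Aᵢ : a₀ + a i ≤ suc ∣ A[ fzero ]? CD².⊕? A[ i ]? ∣²
      cauchy-davenport-A₀Aᵢ = CD².cauchy-davenport p (·²-injective p-prime) A[ fzero ]? A[ i ]?
        (C².∣∣>0⇒∃ A[ fzero ]? 1≤a₀) (C².∣∣>0⇒∃ A[ i ]? 1≤aᵢ) a₀+aᵢ≤1+p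
      ∣A₀⊕Aᵢ∣≤r : ∣ A[ fzero ]? CD².⊕? A[ i ]? ∣² ≤ r i
      ∣A₀⊕Aᵢ∣≤r = C².∣∣-mono (A[ fzero ]? CD².⊕? A[ i ]?) (λ z → Â? z ×-dec (ι z ≟ i)) (A₀⊕Aᵢ⊆Âᵢ i≢0)

    lower≤r : ∀ i → lower i ≤ r i
    lower≤r i = by-kind i (i ≟ fzero) (1 ≤? a i)
      where
      open ≤-Reasoning
      by-kind : ∀ j (j≟0 : Dec (j ≡ fzero)) (1≤?aⱼ : Dec (1 ≤ a j)) →
                𝟙 j≟0 * K + 𝟙 (¬? j≟0 ×-dec 1≤?aⱼ) * (K + a j) + freshness j ≤ r j
      by-kind _ (yes refl) _ = begin
        K + 0 + 0 + freshness fzero ≡⟨ cong₂ (λ u v → u + 0 + v) (+-identityʳ K) (freshness≡0 1≤a₀) ⟩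
        K + 0 + 0           ≡⟨ trans (+-identityʳ (K + 0)) (+-identityʳ K) ⟩
        K                   ≤⟨ K≤r₀ 1≤a₀ ⟩
        r fzero             ∎
      by-kind j (no j≢0) (yes 1≤aⱼ) = begin
        K + a j + 0 + freshness j   ≡⟨ cong₂ _+_ (+-identityʳ (K + a j)) (freshness≡0 1≤aⱼ) ⟩
        K + a j + 0         ≡⟨ +-identityʳ (K + a j) ⟩
        K + a j             ≤⟨ K+a≤r j≢0 1≤aⱼ ⟩
        r j                 ∎
      by-kind j (no _) (no _) = freshness≤r j

  a-split : ∀ i → a i ≡ 𝟙 (i ≟ fzero) * a₀ + 𝟙 (occupied? i) * a i
  a-split i = by-kind i (i ≟ fzero) (1 ≤? a i)
    where
    by-kind : ∀ j (j≟0 : Dec (j ≡ fzero)) (1≤?aⱼ : Dec (1 ≤ a j)) →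
              a j ≡ 𝟙 j≟0 * a₀ + 𝟙 (¬? j≟0 ×-dec 1≤?aⱼ) * a j
    by-kind _ (yes refl) _          = sym (trans (+-identityʳ (a₀ + 0)) (+-identityʳ a₀))
    by-kind j (no _)     (yes _)    = sym (+-identityʳ (a j))
    by-kind j (no _)     (no ¬1≤aⱼ) = n<1⇒n≡0 (≰⇒> ¬1≤aⱼ)

  ∑a≡a₀+s′ : ∑[ i ∈ fins ] a i ≡ a₀ + s′
  ∑a≡a₀+s′ = begin
    ∑[ i ∈ fins ] a i
      ≡⟨ ∑-cong fins a-split ⟩
    ∑[ i ∈ fins ] (𝟙 (i ≟ fzero) * a₀ + 𝟙 (occupied? i) * a i)
      ≡⟨ ∑-distrib-+ fins (λ i → 𝟙 (i ≟ fzero) * a₀) (λ i → 𝟙 (occupied? i) * a i) ⟩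
    ∑[ i ∈ fins ] (𝟙 (i ≟ fzero) * a₀) + s′
      ≡⟨ cong (_+ s′) (∑δ₀ a₀) ⟩
    a₀ + s′
      ∎
    where open ≡-Reasoning

  ∑a≤a₀+m*a₀ : (∀ i → a i ≤ a₀) → ∑[ i ∈ fins ] a i ≤ a₀ + m * a₀
  ∑a≤a₀+m*a₀ a≤a₀ = begin
    ∑[ i ∈ fins ] a i
      ≡⟨ ∑-cong fins a-split ⟩
    ∑[ i ∈ fins ] (𝟙 (i ≟ fzero) * a₀ + 𝟙 (occupied? i) * a i)
      ≤⟨ ∑-mono-≤ fins (λ i → +-monoʳ-≤ _ (*-monoʳ-≤ (𝟙 (occupied? i)) (a≤a₀ i))) ⟩
    ∑[ i ∈ fins ] (𝟙 (i ≟ fzero) * a₀ + 𝟙 (occupied? i) * a₀)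
      ≡⟨ ∑-distrib-+ fins (λ i → 𝟙 (i ≟ fzero) * a₀) (λ i → 𝟙 (occupied? i) * a₀) ⟩
    ∑[ i ∈ fins ] (𝟙 (i ≟ fzero) * a₀) + ∑[ i ∈ fins ] (𝟙 (occupied? i) * a₀)
      ≡⟨ cong₂ _+_ (∑δ₀ a₀) (∑𝟙*≡∣∣* occupied? a₀) ⟩
    a₀ + m * a₀
      ∎
    where open ≤-Reasoning

  ∣support∣≡1+m : 1 ≤ a₀ → ∣ support? ∣ ≡ suc m
  ∣support∣≡1+m 1≤a₀ = begin
    ∣ support? ∣                                                       ≡⟨ ∣∣-split support? (_≟ fzero) ⟩
    ∣ (λ i → support? i ×-dec (i ≟ fzero)) ∣ + ∣ support? ∖[ fzero ] ∣
      ≡⟨ cong₂ _+_ ∣support∩0∣≡1 ∣support∖0∣≡m ⟩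
    1 + m                                                              ∎
    where
    open ≡-Reasoning
    ∣support∩0∣≡1 : ∣ (λ i → support? i ×-dec (i ≟ fzero)) ∣ ≡ 1
    ∣support∩0∣≡1 = trans (∣∣-cong (λ i → support? i ×-dec (i ≟ fzero)) (_≟ fzero) proj₂
                                   (λ { refl → 1≤a₀ , refl }))
                          (∣≡∣≡1 fzero)
    ∣support∖0∣≡m : ∣ support? ∖[ fzero ] ∣ ≡ m
    ∣support∖0∣≡m = ∣∣-cong (support? ∖[ fzero ]) occupied? swap swap

  ∣level∣≤1+∣fresh∣ : 1 ≤ a₀ → 2 * m ≤ k → ∀ t → ∣ level? t ∣ ≤ suc ∣ fresh? t ∣
  ∣level∣≤1+∣fresh∣ 1≤a₀ 2m≤k t = by-size (1 ≤? ∣ level? t ∣)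
    where
    open ≤-Reasoning
    bound : ∣ level? t ∣ + ∣ support? ∣ ≤ suc p
    bound = begin
      ∣ level? t ∣ + ∣ support? ∣ ≤⟨ +-monoˡ-≤ ∣ support? ∣ (∣∣-mono (level? t) occupied? proj₁) ⟩
      m + ∣ support? ∣            ≡⟨ cong (m +_) (∣support∣≡1+m 1≤a₀) ⟩
      m + suc m                   ≡⟨ +-suc m m ⟩
      suc (m + m)                 ≡⟨ cong (λ n → suc (m + n)) (+-identityʳ m) ⟨
      suc (2 * m)                 ≤⟨ s≤s (≤-trans 2m≤k (n≤1+n k)) ⟩
      suc p                       ∎
    by-size : Dec (1 ≤ ∣ level? t ∣) → ∣ level? t ∣ ≤ suc ∣ fresh? t ∣
    by-size (no  ∣level∣≱1) = ≤-trans (≤-pred (≰⇒> ∣level∣≱1)) z≤n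
    by-size (yes 1≤∣level∣) = +-cancelˡ-≤ ∣ support? ∣ _ _ (begin
      ∣ support? ∣ + ∣ level? t ∣
        ≡⟨ +-comm ∣ support? ∣ ∣ level? t ∣ ⟩
      ∣ level? t ∣ + ∣ support? ∣
        ≤⟨ cauchy-davenport p (·-injective p-prime) (level? t) support?
             (∣∣>0⇒∃ (level? t) 1≤∣level∣) (fzero , 1≤a₀) bound ⟩
      suc ∣ level? t ⊕? support? ∣
        ≡⟨ cong suc (∣∣-split (level? t ⊕? support?) support?) ⟩
      suc (∣ (λ i → (level? t ⊕? support?) i ×-dec support? i) ∣ + ∣ fresh? t ∣)
        ≤⟨ s≤s (+-monoˡ-≤ ∣ fresh? t ∣
             (∣∣-mono (λ i → (level? t ⊕? support?) i ×-dec support? i) support? proj₂)) ⟩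
      suc (∣ support? ∣ + ∣ fresh? t ∣)
        ≡⟨ +-suc ∣ support? ∣ ∣ fresh? t ∣ ⟨
      ∣ support? ∣ + suc ∣ fresh? t ∣
        ∎)

  level-count : (∀ i → a i ≤ a₀) → ∀ j → ∑[ t ∈ downFrom K ] 𝟙 (level? t j) ≡ 𝟙 (occupied? j) * (a j ∸ 1)
  level-count a≤a₀ j = begin
    ∑[ t ∈ downFrom K ] 𝟙 (level? t j)
      ≡⟨ ∑-cong (downFrom K) (λ t → 𝟙-× (occupied? j) (suc t ≤? a j ∸ 1)) ⟩
    ∑[ t ∈ downFrom K ] (𝟙 (occupied? j) * 𝟙 (suc t ≤? a j ∸ 1))
      ≡⟨ ∑-*ˡ (downFrom K) (𝟙 (occupied? j)) (λ t → 𝟙 (suc t ≤? a j ∸ 1)) ⟩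
    𝟙 (occupied? j) * ∑[ t ∈ downFrom K ] 𝟙 (suc t ≤? a j ∸ 1)
      ≡⟨ cong (𝟙 (occupied? j) *_) (∑𝟙-downFrom-< K (a j ∸ 1)) ⟩
    𝟙 (occupied? j) * (K ⊓ (a j ∸ 1))
      ≡⟨ cong (𝟙 (occupied? j) *_) (m≥n⇒m⊓n≡n (∸-monoˡ-≤ 1 (a≤a₀ j))) ⟩
    𝟙 (occupied? j) * (a j ∸ 1)
      ∎
    where open ≡-Reasoning

  𝟙*[a∸1]+𝟙≡𝟙*a : ∀ j → 𝟙 (occupied? j) * (a j ∸ 1) + 𝟙 (occupied? j) ≡ 𝟙 (occupied? j) * a j
  𝟙*[a∸1]+𝟙≡𝟙*a j with occupied? j
  ... | yes (_ , 1≤aⱼ) = trans (cong (_+ 1) (+-identityʳ (a j ∸ 1)))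
                                (trans (m∸n+n≡m 1≤aⱼ) (sym (+-identityʳ (a j))))
  ... | no _           = refl

  ∑∣level∣+m≡s′ : (∀ i → a i ≤ a₀) → ∑[ t ∈ downFrom K ] ∣ level? t ∣ + m ≡ s′
  ∑∣level∣+m≡s′ a≤a₀ = begin
    ∑[ t ∈ downFrom K ] ∣ level? t ∣ + m
      ≡⟨ cong₂ _+_ (∑-cong (downFrom K) (λ t → ∣∣≡∑𝟙 (level? t))) (∣∣≡∑𝟙 occupied?) ⟩
    ∑[ t ∈ downFrom K ] (∑[ j ∈ fins ] 𝟙 (level? t j)) + ∑[ j ∈ fins ] 𝟙 (occupied? j)
      ≡⟨ cong (_+ ∑[ j ∈ fins ] 𝟙 (occupied? j)) (∑-comm (downFrom K) fins (λ t j → 𝟙 (level? t j))) ⟩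
    ∑[ j ∈ fins ] (∑[ t ∈ downFrom K ] 𝟙 (level? t j)) + ∑[ j ∈ fins ] 𝟙 (occupied? j)
      ≡⟨ cong (_+ ∑[ j ∈ fins ] 𝟙 (occupied? j)) (∑-cong fins (level-count a≤a₀)) ⟩
    ∑[ j ∈ fins ] (𝟙 (occupied? j) * (a j ∸ 1)) + ∑[ j ∈ fins ] 𝟙 (occupied? j)
      ≡⟨ ∑-distrib-+ fins (λ j → 𝟙 (occupied? j) * (a j ∸ 1)) (λ j → 𝟙 (occupied? j)) ⟨
    ∑[ j ∈ fins ] (𝟙 (occupied? j) * (a j ∸ 1) + 𝟙 (occupied? j))
      ≡⟨ ∑-cong fins 𝟙*[a∸1]+𝟙≡𝟙*a ⟩
    s′
      ∎
    where open ≡-Reasoning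

  4p≤∣Â∣ : card² p A? ≡ 2 * p + 1 → (∀ i → a i ≤ a₀) → 2 * a₀ ≤ p + 1 → 2 * m ≤ k → 1 ≤ k → 4 * p ≤ ∣ Â? ∣²
  4p≤∣Â∣ ∣A∣≡2p+1 a≤a₀ 2a₀≤p+1 2m≤k 1≤k =
    restricted-sumset-bound k a₀ m s′ L F ∣ Â? ∣² 4≤a₀ 3≤m a₀+s′≡2p+1 (∑∣level∣+m≡s′ a≤a₀) L≤K+F lower≤∣Â∣
    where
    L : ℕ
    L = ∑[ t ∈ downFrom K ] ∣ level? t ∣
    ∑a≡2p+1 : ∑[ i ∈ fins ] a i ≡ 2 * p + 1
    ∑a≡2p+1 = trans (sym (∣∣²≡∑-cosets A?)) ∣A∣≡2p+1
    a₀+s′≡2p+1 : a₀ + s′ ≡ 2 * p + 1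
    a₀+s′≡2p+1 = trans (sym ∑a≡a₀+s′) ∑a≡2p+1
    2p+1≤a₀+m*a₀ : 2 * p + 1 ≤ a₀ + m * a₀
    2p+1≤a₀+m*a₀ = subst (_≤ a₀ + m * a₀) ∑a≡2p+1 (∑a≤a₀+m*a₀ a≤a₀)
    4≤a₀ : 4 ≤ a₀
    4≤a₀ = sizes⇒4≤a₀ k a₀ m 1≤k 2p+1≤a₀+m*a₀ 2m≤k
    3≤m : 3 ≤ m
    3≤m = sizes⇒3≤m k a₀ m 1≤k 2p+1≤a₀+m*a₀ 2a₀≤p+1
    1≤a₀ : 1 ≤ a₀
    1≤a₀ = ≤-trans (s≤s z≤n) 4≤a₀
    L≤K+F : L ≤ K + F
    L≤K+F = begin
      L                                             ≤⟨ ∑-mono-≤ (downFrom K) (∣level∣≤1+∣fresh∣ 1≤a₀ 2m≤k) ⟩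
      ∑[ t ∈ downFrom K ] (1 + ∣ fresh? t ∣)        ≡⟨ ∑-distrib-+ (downFrom K) (λ _ → 1) (λ t → ∣ fresh? t ∣) ⟩
      ∑[ t ∈ downFrom K ] 1 + F
        ≡⟨ cong (_+ F) (trans (∑1≡length (downFrom K)) (length-downFrom K)) ⟩
      K + F                                         ∎
      where open ≤-Reasoning
    lower≤∣Â∣ : K + (m * K + s′) + F ≤ ∣ Â? ∣²
    lower≤∣Â∣ = begin
      K + (m * K + s′) + F     ≡⟨ ∑lower≡ ⟨
      ∑[ i ∈ fins ] lower i    ≤⟨ ∑-mono-≤ fins (lower≤r a≤a₀ 2a₀≤p+1 1≤a₀) ⟩
      ∑[ i ∈ fins ] r i        ≡⟨ ∣∣²≡∑-cosets Â? ⟨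
      ∣ Â? ∣²                  ∎
      where open ≤-Reasoning

lemma2p16 : (p : ℕ) .{{_ : NonZero p}} → Prime p → 5 ≤ p →
            (A : Pred (ℤ² p) 0ℓ) (A? : Decidable A) →
            card² p A? ≡ 2 * p + 1 →
            (H : Pred (ℤ² p) 0ℓ) (H? : Decidable H) →
            IsSubgroup p H → card² p H? ≡ p →
            (ι : ℤ² p → ℤ p) → IsCosetIndexing p H ι →
            (∀ i → cardAᵢ p A? ι i ≤ cardAᵢ p A? ι (zeroℤ p)) →
            2 * cardAᵢ p A? ι (zeroℤ p) ≤ p + 1 →
            2 * nonEmptyCosetCount p A? ι ≤ p ∸ 1 →
            4 * p ≤ cardRestrictedSumset p A?
lemma2p16 (suc k) p-prime (s≤s 4≤k) _ A? ∣A∣≡2p+1 _ _ _ _ ι ι-indexes-cosets a≤a₀ 2a₀≤p+1 2m≤p-1 =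
  CosetCounting.4p≤∣Â∣ k p-prime A? ι (IsCosetIndexing.additive ι-indexes-cosets)
    ∣A∣≡2p+1 a≤a₀ 2a₀≤p+1 2m≤p-1 (≤-trans (s≤s z≤n) 4≤k)
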